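{- Let $m,n$ be positive integers with $m$ even. Then $\alpha(m,n)\le\alpha(m-1,n)$. Moreover, if both $m$ and $n$ are even, then $\alpha(m,n)=\alpha(m-1,n)=\alpha(m,n-1)\le\alpha(m-1,n-1)$.
   Context: For positive integers $m,n$, let $A(m,n)$ be the set of all $m\times n$ matrices with every entry in $\{1,-1\}$ such that every row sum and every column sum has absolute value at most $1$, and let $\alpha(m,n)=|A(m,n)|$. -}

module Defs where

open import Data.Nat using (ℕ; zero; suc)
open import Data.Integer using (ℤ; +_; -_; _+_; ∣_∣)
open import Data.Integer.Base using (0ℤ; 1ℤ)
open import Data.Nat as ℕ using (_≤_; _≤?_)
open import Data.List using (List; []; _∷_; map; concatMap; filter; length)
open import Data.Vec using (Vec; []; _∷_; foldr; transpose)
open import Data.Vec.Relation.Unary.All using (All; all?)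
open import Data.Product using (_×_)
open import Relation.Nullary using (Dec)
open import Relation.Nullary.Decidable using (_×-dec_)

data Sign : Set where
  plus minus : Sign

val : Sign → ℤ
val plus  = 1ℤ
val minus = - 1ℤ

Matrix : ℕ → ℕ → Set
Matrix m n = Vec (Vec Sign n) m

allVecs : (n : ℕ) → List (Vec Sign n)
allVecs zero = [] ∷ []
allVecs (suc n) = concatMap (λ v → (plus ∷ v) ∷ (minus ∷ v) ∷ []) (allVecs n)

allMatrices : (m n : ℕ) → List (Matrix m n)
allMatrices zero n = [] ∷ []
allMatrices (suc m) n =
  concatMap (λ r → map (r ∷_) (allMatrices m n)) (allVecs n)

vsum : {n : ℕ} → Vec Sign n → ℤ
vsum = foldr _ (λ s acc → val s + acc) 0ℤ

Balanced : {n : ℕ} → Vec Sign n → Set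
Balanced v = ∣ vsum v ∣ ≤ 1

balanced? : {n : ℕ} → (v : Vec Sign n) → Dec (Balanced v)
balanced? v = ∣ vsum v ∣ ≤? 1

InA : {m n : ℕ} → Matrix m n → Set
InA M = All Balanced M × All Balanced (transpose M)

inA? : {m n : ℕ} → (M : Matrix m n) → Dec (InA M)
inA? M = all? balanced? M ×-dec all? balanced? (transpose M)

α : ℕ → ℕ → ℕ
α m n = length (filter inA? (allMatrices m n))

-- Let m be even.  In a matrix of A(m,n) every column has even length and
-- |sum| ≤ 1, hence sum 0, so its top entry is determined by the rest of the
-- column.  Hence deleting the first row maps A(m,n) injectively into
-- A(m-1,n): the deleted row is the "balancing row" of what remains.  When n
-- is even too, putting the balancing row on top of a matrix of A(m-1,n)
-- gives a matrix of A(m,n): the new columns sum to 0, so the new total is 0,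
-- and the old rows (of even length n) sum to 0, so the new row sums to 0.
-- With α(m,n) = α(n,m) (transposition) the theorem follows.
module Submission where

open import Defs
open import Data.Nat using (ℕ; zero; suc; _≤_; _∸_; z≤n; s≤s; parity)
open import Data.Nat.Properties using (≤-antisym; m+n≤o⇒n≤o; module ≤-Reasoning)
open import Data.Nat.Divisibility using (_∣_; divides)
open import Data.Parity.Base using (Parity; 0ℙ; 1ℙ; _⁻¹)
open import Data.Parity.Properties using (⁻¹-selfInverse; suc-homo-⁻¹; *-homo-*; *-zeroʳ)
open import Data.Integer using (ℤ; +_; -[1+_]; -_; _+_; ∣_∣)
open import Data.Integer.Base using (0ℤ; 1ℤ; -1ℤ)
open import Data.Integer.Properties using (+-identityʳ)
open import Data.Integer.Tactic.RingSolver using (solve-∀)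
open import Data.Fin using (zero; suc)
open import Data.List using (List; []; _∷_; length; filter; map; concatMap; removeAt)
open import Data.List.Properties using (length-map; length-removeAt′)
open import Data.List.Relation.Unary.All as ListAll using ([]; _∷_)
open import Data.List.Relation.Unary.All.Properties using (all-filter)
open import Data.List.Relation.Unary.Any using (here; there; index)
open import Data.List.Relation.Unary.AllPairs using ([]; _∷_)
open import Data.List.Relation.Unary.Unique.Propositional using (Unique)
open import Data.List.Relation.Unary.Unique.Propositional.Properties using (++⁺; map⁺; map⁻; filter⁺)
open import Data.List.Membership.Propositional using (_∈_; find; lose)
open import Data.List.Membership.Propositional.Properties
  using (∈-map⁺; ∈-map⁻; ∈-concatMap⁺; ∈-concatMap⁻; ∈-filter⁺; ∈-filter⁻)
open import Data.Vec as Vec using (Vec; []; _∷_; zipWith; transpose; lookup; replicate; tabulate)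
open import Data.Vec.Properties using (∷-injectiveʳ; zipWith-is-⊛; lookup-zipWith; tabulate∘lookup; tabulate-cong)
open import Data.Vec.Relation.Unary.All as VecAll using (All; []; _∷_)
open import Data.Product using (∃-syntax; _×_; _,_; proj₁; proj₂)
open import Data.Sum using (_⊎_; inj₁; inj₂)
open import Data.Empty using (⊥)
open import Relation.Nullary using (contradiction)
open import Relation.Unary using (Decidable)
open import Relation.Binary.PropositionalEquality

∈-removeAt : ∀ {A : Set} {x y : A} {xs : List A} (x∈xs : x ∈ xs) →
  y ∈ xs → y ≢ x → y ∈ removeAt xs (index x∈xs)
∈-removeAt (here refl) (here refl) y≢x = contradiction refl y≢x
∈-removeAt (here refl) (there y∈xs) _  = y∈xs
∈-removeAt (there _)   (here refl)  _  = here refl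
∈-removeAt (there x∈xs) (there y∈xs) y≢x = there (∈-removeAt x∈xs y∈xs y≢x)

unique-⊆-length : ∀ {A : Set} {xs ys : List A} → Unique xs →
  (∀ {x} → x ∈ xs → x ∈ ys) → length xs ≤ length ys
unique-⊆-length {xs = []} _ _ = z≤n
unique-⊆-length {xs = x ∷ xs} {ys} (x∉xs ∷ xs!) xs⊆ys = begin
  suc (length xs)                           ≤⟨ s≤s (unique-⊆-length xs! xs⊆ys─x) ⟩
  suc (length (removeAt ys (index x∈ys)))   ≡⟨ sym (length-removeAt′ ys (index x∈ys)) ⟩
  length ys                                 ∎
  where
  open ≤-Reasoning
  x∈ys : x ∈ ys
  x∈ys = xs⊆ys (here refl)
  xs⊆ys─x : ∀ {y} → y ∈ xs → y ∈ removeAt ys (index x∈ys)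
  xs⊆ys─x y∈xs = ∈-removeAt x∈ys (xs⊆ys (there y∈xs)) (λ y≡x → ListAll.lookup x∉xs y∈xs (sym y≡x))

map-leftInverse : ∀ {A B : Set} {P : A → Set} (f : A → B) (g : B → A) →
  (∀ {a} → P a → g (f a) ≡ a) → {as : List A} → ListAll.All P as → map g (map f as) ≡ as
map-leftInverse f g g-undoes-f [] = refl
map-leftInverse f g g-undoes-f (pa ∷ pas) = cong₂ _∷_ (g-undoes-f pa) (map-leftInverse f g g-undoes-f pas)

count-≤ : ∀ {A B : Set} {P : A → Set} {Q : B → Set} (P? : Decidable P) (Q? : Decidable Q)
  (f : A → B) (g : B → A) → (∀ {a} → P a → g (f a) ≡ a) → (∀ {a} → P a → Q (f a)) →
  {xs : List A} {ys : List B} → Unique xs → (∀ b → b ∈ ys) →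
  length (filter P? xs) ≤ length (filter Q? ys)
count-≤ P? Q? f g g-undoes-f f-pres {xs} {ys} xs! ys-complete = begin
  length (filter P? xs)          ≡⟨ sym (length-map f (filter P? xs)) ⟩
  length (map f (filter P? xs))  ≤⟨ unique-⊆-length image! image⊆ ⟩
  length (filter Q? ys)          ∎
  where
  open ≤-Reasoning
  image! : Unique (map f (filter P? xs))
  image! = map⁻ (subst Unique (sym (map-leftInverse f g g-undoes-f (all-filter P? xs))) (filter⁺ P? xs!))
  image⊆ : ∀ {b} → b ∈ map f (filter P? xs) → b ∈ filter Q? ys
  image⊆ b∈ with ∈-map⁻ f b∈
  ... | a , a∈ , refl = ∈-filter⁺ Q? (ys-complete (f a)) (f-pres (proj₂ (∈-filter⁻ P? {xs = xs} a∈)))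

unique-concatMap : ∀ {A B : Set} (f : A → List B) (g : B → A) →
  (∀ {x y} → y ∈ f x → g y ≡ x) → (∀ x → Unique (f x)) →
  {xs : List A} → Unique xs → Unique (concatMap f xs)
unique-concatMap f g g-recovers f! {[]} [] = []
unique-concatMap f g g-recovers f! {x ∷ xs} (x∉xs ∷ xs!) =
  ++⁺ (f! x) (unique-concatMap f g g-recovers f! xs!) disjoint
  where
  disjoint : ∀ {y} → y ∈ f x × y ∈ concatMap f xs → ⊥
  disjoint (y∈fx , y∈rest) with find (∈-concatMap⁻ f {xs = xs} y∈rest)
  ... | x′ , x′∈xs , y∈fx′ = ListAll.lookup x∉xs x′∈xs (trans (sym (g-recovers y∈fx)) (g-recovers y∈fx′))

consSigns : ∀ {n} → Vec Sign n → List (Vec Sign (suc n))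
consSigns v = (plus ∷ v) ∷ (minus ∷ v) ∷ []

allVecs-complete : ∀ n (v : Vec Sign n) → v ∈ allVecs n
allVecs-complete zero    []      = here refl
allVecs-complete (suc n) (s ∷ v) = ∈-concatMap⁺ consSigns (lose (allVecs-complete n v) (s∈ s))
  where
  s∈ : ∀ s → (s ∷ v) ∈ consSigns v
  s∈ plus  = here refl
  s∈ minus = there (here refl)

allVecs-unique : ∀ n → Unique (allVecs n)
allVecs-unique zero    = [] ∷ []
allVecs-unique (suc n) =
  unique-concatMap consSigns Vec.tail tail-recovers (λ _ → ((λ ()) ∷ []) ∷ [] ∷ []) (allVecs-unique n)
  where
  tail-recovers : ∀ {v w} → w ∈ consSigns v → Vec.tail w ≡ v
  tail-recovers (here refl)         = refl
  tail-recovers (there (here refl)) = refl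

allMatrices-complete : ∀ m n (M : Matrix m n) → M ∈ allMatrices m n
allMatrices-complete zero    n []      = here refl
allMatrices-complete (suc m) n (r ∷ M) =
  ∈-concatMap⁺ (λ r → map (r ∷_) (allMatrices m n))
    (lose (allVecs-complete n r) (∈-map⁺ (r ∷_) (allMatrices-complete m n M)))

allMatrices-unique : ∀ m n → Unique (allMatrices m n)
allMatrices-unique zero    n = [] ∷ []
allMatrices-unique (suc m) n =
  unique-concatMap (λ r → map (r ∷_) (allMatrices m n)) Vec.head head-recovers
    (λ r → map⁺ ∷-injectiveʳ (allMatrices-unique m n)) (allVecs-unique n)
  where
  head-recovers : ∀ {r M} → M ∈ map (r ∷_) (allMatrices m n) → Vec.head M ≡ r
  head-recovers M∈ with ∈-map⁻ _ M∈
  ... | _ , _ , refl = refl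

IntParity : Parity → ℤ → Set
IntParity 0ℙ z = ∃[ k ] z ≡ k + k
IntParity 1ℙ z = ∃[ k ] z ≡ 1ℤ + (k + k)

sign-flips-parity : ∀ s p z → IntParity p z → IntParity (p ⁻¹) (val s + z)
sign-flips-parity plus  0ℙ _ (k , refl) = k , refl
sign-flips-parity minus 0ℙ _ (k , refl) = k + -1ℤ , identity k
  where
  identity : ∀ k → -1ℤ + (k + k) ≡ 1ℤ + ((k + -1ℤ) + (k + -1ℤ))
  identity = solve-∀
sign-flips-parity plus  1ℙ _ (k , refl) = k + 1ℤ , identity k
  where
  identity : ∀ k → 1ℤ + (1ℤ + (k + k)) ≡ (k + 1ℤ) + (k + 1ℤ)
  identity = solve-∀
sign-flips-parity minus 1ℙ _ (k , refl) = k , identity k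
  where
  identity : ∀ k → -1ℤ + (1ℤ + (k + k)) ≡ k + k
  identity = solve-∀

vsum-parity : ∀ {L} (v : Vec Sign L) → IntParity (parity L) (vsum v)
vsum-parity []                = 0ℤ , refl
vsum-parity {suc L} (s ∷ v)   =
  subst (λ p → IntParity p (vsum (s ∷ v))) (⁻¹-selfInverse (suc-homo-⁻¹ L))
    (sign-flips-parity s (parity L) (vsum v) (vsum-parity v))

even-small : ∀ {z} → IntParity 0ℙ z → ∣ z ∣ ≤ 1 → z ≡ 0ℤ
even-small (+ zero    , refl) _       = refl
even-small (+ suc a   , refl) (s≤s h) = contradiction (m+n≤o⇒n≤o a h) λ ()
even-small (-[1+ a ]  , refl) (s≤s ())

odd-small : ∀ {z} → IntParity 1ℙ z → ∣ z ∣ ≤ 1 → z ≡ 1ℤ ⊎ z ≡ -1ℤ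
odd-small (+ zero        , refl) _ = inj₁ refl
odd-small (+ suc a       , refl) (s≤s ())
odd-small (-[1+ zero ]   , refl) _ = inj₂ refl
odd-small (-[1+ suc a ]  , refl) (s≤s ())

even-balanced-sum : ∀ {L} → parity L ≡ 0ℙ → (v : Vec Sign L) → Balanced v → vsum v ≡ 0ℤ
even-balanced-sum L-even v = even-small (subst (λ p → IntParity p (vsum v)) L-even (vsum-parity v))

odd-balanced-sum : ∀ {L} → parity L ≡ 1ℙ → (v : Vec Sign L) → Balanced v → vsum v ≡ 1ℤ ⊎ vsum v ≡ -1ℤ
odd-balanced-sum L-odd v = odd-small (subst (λ p → IntParity p (vsum v)) L-odd (vsum-parity v))

even-suc⇒odd : ∀ L → parity (suc L) ≡ 0ℙ → parity L ≡ 1ℙ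
even-suc⇒odd L sucL-even = trans (sym (suc-homo-⁻¹ L)) (cong _⁻¹ sucL-even)

divisible⇒even : ∀ {m} → 2 ∣ m → parity m ≡ 0ℙ
divisible⇒even (divides q refl) = trans (*-homo-* q 2) (*-zeroʳ (parity q))

opposite : ℤ → Sign
opposite (+ _)     = minus
opposite -[1+ _ ]  = plus

-- The entry which, put on top of a column c, makes the column sum vanish
-- (when c has odd length and is balanced).
balancingSign : ∀ {k} → Vec Sign k → Sign
balancingSign c = opposite (vsum c)

zero-balanced : ∀ {k} (v : Vec Sign k) → vsum v ≡ 0ℤ → Balanced v
zero-balanced v sum≡0 rewrite sum≡0 = z≤n

sign-cancel : ∀ s z → val s + z ≡ 0ℤ → z ≡ - val s
sign-cancel s z sum≡0 = begin
  z                         ≡⟨ identity (val s) z ⟩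
  - val s + (val s + z)     ≡⟨ cong (λ x → - val s + x) sum≡0 ⟩
  - val s + 0ℤ              ≡⟨ +-identityʳ (- val s) ⟩
  - val s                   ∎
  where
  open ≡-Reasoning
  identity : ∀ a z → z ≡ - a + (a + z)
  identity = solve-∀

balancingSign-cancels : ∀ {k} → parity (suc k) ≡ 0ℙ → (c : Vec Sign k) → Balanced c →
  vsum (balancingSign c ∷ c) ≡ 0ℤ
balancingSign-cancels {k} sucK-even c c-bal with odd-balanced-sum (even-suc⇒odd k sucK-even) c c-bal
... | inj₁ sum≡1  rewrite sum≡1  = refl
... | inj₂ sum≡-1 rewrite sum≡-1 = refl

top-determined : ∀ {k} → parity (suc k) ≡ 0ℙ → (s : Sign) (c : Vec Sign k) → Balanced (s ∷ c) →
  balancingSign c ≡ s × Balanced c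
top-determined sucK-even s c col-bal
  with sign-cancel s (vsum c) (even-balanced-sum sucK-even (s ∷ c) col-bal)
top-determined _ plus  c _ | rest≡-1 rewrite rest≡-1 = refl , s≤s z≤n
top-determined _ minus c _ | rest≡1  rewrite rest≡1  = refl , s≤s z≤n

columns-delete : ∀ {k n} → parity (suc k) ≡ 0ℙ → (r : Vec Sign n) (C : Vec (Vec Sign k) n) →
  All Balanced (zipWith _∷_ r C) → Vec.map balancingSign C ≡ r × All Balanced C
columns-delete sucK-even []      []      []                = refl , []
columns-delete sucK-even (s ∷ r) (c ∷ C) (col-bal ∷ cols-bal) =
  let s-recovered , c-bal = top-determined sucK-even s c col-bal
      r-recovered , C-bal = columns-delete sucK-even r C cols-bal
  in cong₂ _∷_ s-recovered r-recovered , c-bal ∷ C-bal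

columns-extend : ∀ {k n} → parity (suc k) ≡ 0ℙ → (C : Vec (Vec Sign k) n) → All Balanced C →
  All (λ c → vsum c ≡ 0ℤ) (zipWith _∷_ (Vec.map balancingSign C) C)
columns-extend sucK-even []      []              = []
columns-extend sucK-even (c ∷ C) (c-bal ∷ C-bal) =
  balancingSign-cancels sucK-even c c-bal ∷ columns-extend sucK-even C C-bal

transpose-∷ : ∀ {A : Set} {m n} (r : Vec A n) (M : Vec (Vec A n) m) →
  transpose (r ∷ M) ≡ zipWith _∷_ r (transpose M)
transpose-∷ r M = sym (zipWith-is-⊛ _∷_ r (transpose M))

lookup-transpose : ∀ {A : Set} {m n} (M : Vec (Vec A n) m) i j →
  lookup (lookup (transpose M) j) i ≡ lookup (lookup M i) j
lookup-transpose (r ∷ M) i j = begin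
  lookup (lookup (transpose (r ∷ M)) j) i                 ≡⟨ cong (λ T → lookup (lookup T j) i) (transpose-∷ r M) ⟩
  lookup (lookup (zipWith _∷_ r (transpose M)) j) i       ≡⟨ cong (λ c → lookup c i) (lookup-zipWith _∷_ j r (transpose M)) ⟩
  lookup (lookup r j ∷ lookup (transpose M) j) i          ≡⟨ top-or-below i ⟩
  lookup (lookup (r ∷ M) i) j                             ∎
  where
  open ≡-Reasoning
  top-or-below : ∀ i → lookup (lookup r j ∷ lookup (transpose M) j) i ≡ lookup (lookup (r ∷ M) i) j
  top-or-below zero    = refl
  top-or-below (suc i) = lookup-transpose M i j

lookup-ext : ∀ {A : Set} {n} {xs ys : Vec A n} → (∀ i → lookup xs i ≡ lookup ys i) → xs ≡ ys
lookup-ext {xs = xs} {ys} same = begin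
  xs                  ≡⟨ sym (tabulate∘lookup xs) ⟩
  tabulate (lookup xs) ≡⟨ tabulate-cong same ⟩
  tabulate (lookup ys) ≡⟨ tabulate∘lookup ys ⟩
  ys                  ∎
  where open ≡-Reasoning

transpose-involutive : ∀ {A : Set} {m n} (M : Vec (Vec A n) m) → transpose (transpose M) ≡ M
transpose-involutive M = lookup-ext λ i → lookup-ext λ j →
  trans (lookup-transpose (transpose M) j i) (lookup-transpose M i j)

total : ∀ {m n} → Matrix m n → ℤ
total []      = 0ℤ
total (r ∷ M) = vsum r + total M

total-zero : ∀ {m n} (M : Matrix m n) → All (λ r → vsum r ≡ 0ℤ) M → total M ≡ 0ℤ
total-zero []      []              = refl
total-zero (r ∷ M) (r≡0 ∷ rows≡0) = cong₂ _+_ r≡0 (total-zero M rows≡0)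

total-zipWith : ∀ {k n} (r : Vec Sign n) (C : Matrix n k) →
  total (zipWith _∷_ r C) ≡ vsum r + total C
total-zipWith []      []      = refl
total-zipWith (s ∷ r) (c ∷ C) = begin
  (val s + vsum c) + total (zipWith _∷_ r C)  ≡⟨ cong (λ t → (val s + vsum c) + t) (total-zipWith r C) ⟩
  (val s + vsum c) + (vsum r + total C)       ≡⟨ interchange (val s) (vsum c) (vsum r) (total C) ⟩
  (val s + vsum r) + (vsum c + total C)       ∎
  where
  open ≡-Reasoning
  interchange : ∀ a b c d → (a + b) + (c + d) ≡ (a + c) + (b + d)
  interchange = solve-∀

total-transpose : ∀ {m n} (M : Matrix m n) → total (transpose M) ≡ total M
total-transpose {n = n} [] = total-zero (replicate n []) (VecAll.universal (λ { [] → refl }) (replicate n []))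
total-transpose (r ∷ M) = begin
  total (transpose (r ∷ M))               ≡⟨ cong total (transpose-∷ r M) ⟩
  total (zipWith _∷_ r (transpose M))     ≡⟨ total-zipWith r (transpose M) ⟩
  vsum r + total (transpose M)            ≡⟨ cong (λ t → vsum r + t) (total-transpose M) ⟩
  vsum r + total M                        ∎
  where open ≡-Reasoning

balancingRow : ∀ {k n} → Matrix k n → Vec Sign n
balancingRow M = Vec.map balancingSign (transpose M)

extend : ∀ {k n} → Matrix k n → Matrix (suc k) n
extend M = balancingRow M ∷ M

delete-first-row : ∀ {k n} → parity (suc k) ≡ 0ℙ → (r : Vec Sign n) (M : Matrix k n) →
  InA (r ∷ M) → InA M × extend M ≡ r ∷ M
delete-first-row sucK-even r M (_ ∷ rows-bal , cols-bal) =
  let r-recovered , M-cols-bal =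
        columns-delete sucK-even r (transpose M) (subst (All Balanced) (transpose-∷ r M) cols-bal)
  in (rows-bal , M-cols-bal) , cong (_∷ M) r-recovered

-- For suc k and n even, adding the balancing row maps A(k, n) into
-- A(suc k, n): the new columns sum to 0, so the new total is 0, and the old
-- rows (of even length) sum to 0, so the new row sums to 0 as well.
extend-inA : ∀ {k n} → parity (suc k) ≡ 0ℙ → parity n ≡ 0ℙ → (M : Matrix k n) →
  InA M → InA (extend M)
extend-inA {n = n} sucK-even n-even M (rows-bal , cols-bal) =
  (zero-balanced row row≡0 ∷ rows-bal) , VecAll.map (λ {c} → zero-balanced c) cols≡0
  where
  row : Vec Sign n
  row = balancingRow M
  cols≡0 : All (λ c → vsum c ≡ 0ℤ) (transpose (extend M))
  cols≡0 = subst (All (λ c → vsum c ≡ 0ℤ)) (sym (transpose-∷ row M))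
             (columns-extend sucK-even (transpose M) cols-bal)
  rows≡0 : All (λ r → vsum r ≡ 0ℤ) M
  rows≡0 = VecAll.map (λ {r} → even-balanced-sum n-even r) rows-bal
  row≡0 : vsum row ≡ 0ℤ
  row≡0 = begin
    vsum row                       ≡⟨ sym (+-identityʳ (vsum row)) ⟩
    vsum row + 0ℤ                  ≡⟨ cong (λ t → vsum row + t) (sym (total-zero M rows≡0)) ⟩
    total (extend M)               ≡⟨ sym (total-transpose (extend M)) ⟩
    total (transpose (extend M))   ≡⟨ total-zero (transpose (extend M)) cols≡0 ⟩
    0ℤ                             ∎
    where open ≡-Reasoning

transpose-inA : ∀ {m n} (M : Matrix m n) → InA M → InA (transpose M)
transpose-inA M (rows-bal , cols-bal) = cols-bal , subst (All Balanced) (sym (transpose-involutive M)) rows-bal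

α-delete : ∀ k n → parity (suc k) ≡ 0ℙ → α (suc k) n ≤ α k n
α-delete k n sucK-even =
  count-≤ inA? inA? Vec.tail extend extend-tail tail-inA (allMatrices-unique (suc k) n) (allMatrices-complete k n)
  where
  extend-tail : ∀ {M : Matrix (suc k) n} → InA M → extend (Vec.tail M) ≡ M
  extend-tail {r ∷ M} M-inA = proj₂ (delete-first-row sucK-even r M M-inA)
  tail-inA : ∀ {M : Matrix (suc k) n} → InA M → InA (Vec.tail M)
  tail-inA {r ∷ M} M-inA = proj₁ (delete-first-row sucK-even r M M-inA)

α-extend : ∀ k n → parity (suc k) ≡ 0ℙ → parity n ≡ 0ℙ → α k n ≤ α (suc k) n
α-extend k n sucK-even n-even =
  count-≤ inA? inA? extend Vec.tail (λ _ → refl) (extend-inA sucK-even n-even _)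
    (allMatrices-unique k n) (allMatrices-complete (suc k) n)

α-symmetric : ∀ m n → α m n ≡ α n m
α-symmetric m n = ≤-antisym (α-transpose m n) (α-transpose n m)
  where
  α-transpose : ∀ m n → α m n ≤ α n m
  α-transpose m n = count-≤ inA? inA? transpose transpose (λ {M} _ → transpose-involutive M)
    (transpose-inA _) (allMatrices-unique m n) (allMatrices-complete n m)

α-even-rows : ∀ k n → parity (suc k) ≡ 0ℙ → parity n ≡ 0ℙ → α (suc k) n ≡ α k n
α-even-rows k n sucK-even n-even = ≤-antisym (α-delete k n sucK-even) (α-extend k n sucK-even n-even)

mainTheorem12 : (m n : ℕ) → 1 ≤ m → 1 ≤ n → 2 ∣ m →
    (α m n ≤ α (m ∸ 1) n)
    × (2 ∣ n →
    (α m n ≡ α (m ∸ 1) n) × (α (m ∸ 1) n ≡ α m (n ∸ 1))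
    × (α m (n ∸ 1) ≤ α (m ∸ 1) (n ∸ 1)))
mainTheorem12 zero    _       ()  _   _
mainTheorem12 (suc k) zero    _   ()  _
mainTheorem12 (suc k) (suc l) _   _   2∣m = α-delete k (suc l) m-even , λ 2∣n →
  let n-even  = divisible⇒even 2∣n
      rows-eq = α-even-rows k (suc l) m-even n-even
  in rows-eq , row-vs-column n-even rows-eq , α-delete k l m-even
  where
  m-even : parity (suc k) ≡ 0ℙ
  m-even = divisible⇒even 2∣m
  row-vs-column : parity (suc l) ≡ 0ℙ → α (suc k) (suc l) ≡ α k (suc l) → α k (suc l) ≡ α (suc k) l
  row-vs-column n-even rows-eq = begin
    α k (suc l)        ≡⟨ sym rows-eq ⟩
    α (suc k) (suc l)  ≡⟨ α-symmetric (suc k) (suc l) ⟩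
    α (suc l) (suc k)  ≡⟨ α-even-rows l (suc k) n-even m-even ⟩
    α l (suc k)        ≡⟨ α-symmetric l (suc k) ⟩
    α (suc k) l        ∎
    where open ≡-Reasoning
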